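{- Let $q$ be a prime power and $d\geq 1$. For all generators $\omega,\omega'$ of $F_q^*$, the orientation-preserving automorphism groups $\mathrm{Aut}^+\mathcal H(d,\omega)$ and $\mathrm{Aut}^+\mathcal H(d,\omega')$ are isomorphic.
   Context: $F_q$ is the field with $q$ elements, $n=d(q-1)$, $V=F_q^d$ (row vectors) with standard basis $e_1,\dots,e_d$. $M_\omega$ is the $d\times d$ matrix with $m_{i,i+1}=1$ ($1\le i\le d-1$), $m_{d,1}=\omega$, other entries $0$. The Hamming map $\mathcal H(d,\omega)$ is the Cayley map (on a compact oriented surface) of the additive group $V$ with respect to $S=\{\lambda e_i:\lambda\in F_q^*\}$ in which the rotation at every vertex $v$ sends the neighbour $v+e_1M_\omega^{i}$ to $v+e_1M_\omega^{i+1}$ (indices mod $n$). $\mathrm{Aut}^+\mathcal M$ denotes the group of orientation-preserving automorphisms of a map $\mathcal M$. -}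

module Defs where

open import Level using (0ℓ)
open import Data.Nat as ℕ using (ℕ; zero; suc; _≤_; _^_)
open import Data.Nat.Primality using (Prime)
open import Data.Fin as Fin using (Fin; toℕ)
open import Data.Vec as Vec using (Vec; tabulate; lookup; zipWith; foldr; map)
open import Data.Product using (Σ; ∃; ∃-syntax; _×_; _,_; proj₁; proj₂)
open import Relation.Nullary using (¬_; yes; no)
open import Relation.Binary.PropositionalEquality using (_≡_)
open import Function.Bundles using (_↔_)
open import Algebra.Structures using (IsCommutativeRing)
open import Algebra.Bundles.Raw using (RawGroup)

IsPrimePower : ℕ → Set
IsPrimePower q = ∃[ p ] ∃[ k ] (Prime p × 1 ≤ k × q ≡ p ^ k)

record FiniteField (q : ℕ) : Set₁ where
  infixl 6 _+_
  infixl 7 _*_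
  field
    Carrier : Set
    _+_ _*_ : Carrier → Carrier → Carrier
    -_      : Carrier → Carrier
    0# 1#   : Carrier
    isCommutativeRing : IsCommutativeRing _≡_ _+_ _*_ -_ 0# 1#
    0≢1     : ¬ (0# ≡ 1#)
    inverse : ∀ x → ¬ (x ≡ 0#) → ∃[ y ] (x * y ≡ 1#)
    card    : Carrier ↔ Fin q

  pow : Carrier → ℕ → Carrier
  pow x zero    = 1#
  pow x (suc k) = x * pow x k

  IsGenerator : Carrier → Set
  IsGenerator ω = ¬ (ω ≡ 0#) × (∀ x → ¬ (x ≡ 0#) → ∃[ k ] (x ≡ pow ω k))

-- Hamming maps, combinatorially: darts are pairs (v , s) with v ∈ V and
-- s ∈ S (the arc from v to v + s); the rotation R sends (v , s) to
-- (v , s M_ω) (since e₁M^i ↦ e₁M^{i+1} is right multiplication by M_ω),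
-- and the dart-reversing involution L sends (v , s) to (v + s , - s).

module Hamming {q : ℕ} (F : FiniteField q) (d : ℕ) where
  open FiniteField F

  V : Set
  V = Vec Carrier d

  Matrix : Set
  Matrix = Vec (Vec Carrier d) d

  _+ᵥ_ : V → V → V
  _+ᵥ_ = zipWith _+_

  -ᵥ_ : V → V
  -ᵥ_ = map -_

  scaledBasis : Carrier → Fin d → V
  scaledBasis c i = tabulate λ j → if-eq i j
    where
    if-eq : Fin d → Fin d → Carrier
    if-eq i j with i Fin.≟ j
    ... | yes _ = c
    ... | no  _ = 0#

  _·ₘ_ : V → Matrix → V
  s ·ₘ M = tabulate λ j → foldr (λ _ → Carrier) _+_ 0#
                             (zipWith (λ sᵢ row → sᵢ * lookup row j) s M)

  -- M_ω : m_{i,i+1} = 1 (1 ≤ i ≤ d-1), m_{d,1} = ω, all others 0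
  -- (0-indexed: m_{i,i+1} = 1 for i+1 < d, m_{d-1,0} = ω)
  Mω : Carrier → Matrix
  Mω ω = tabulate λ i → tabulate λ j → entry i j
    where
    entry : Fin d → Fin d → Carrier
    entry i j with toℕ j ℕ.≟ suc (toℕ i)
    ... | yes _ = 1#
    ... | no _ with suc (toℕ i) ℕ.≟ d | toℕ j ℕ.≟ 0
    ...   | yes _ | yes _ = ω
    ...   | _     | _     = 0#

  InS : V → Set
  InS s = ∃[ i ] ∃[ c ] (¬ (c ≡ 0#) × s ≡ scaledBasis c i)

  Pair : Set
  Pair = V × V

  IsDart : Pair → Set
  IsDart (v , s) = InS s

  R : Carrier → Pair → Pair
  R ω (v , s) = v , (s ·ₘ Mω ω)

  L : Pair → Pair
  L (v , s) = (v +ᵥ s) , (-ᵥ s)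

  -- orientation-preserving automorphisms of H(d, ω): permutations of the
  -- dart set commuting with R and L (functions are compared on darts only)
  record Aut⁺ (ω : Carrier) : Set where
    field
      fun     : Pair → Pair
      inv     : Pair → Pair
      fun-dart : ∀ x → IsDart x → IsDart (fun x)
      inv-dart : ∀ x → IsDart x → IsDart (inv x)
      inv-fun  : ∀ x → IsDart x → inv (fun x) ≡ x
      fun-inv  : ∀ x → IsDart x → fun (inv x) ≡ x
      comm-R   : ∀ x → IsDart x → fun (R ω x) ≡ R ω (fun x)
      comm-L   : ∀ x → IsDart x → fun (L x) ≡ L (fun x)
      -- (redundant, since R and L preserve darts; included for convenience)
      inv-comm-R : ∀ x → IsDart x → inv (R ω x) ≡ R ω (inv x)
      inv-comm-L : ∀ x → IsDart x → inv (L x) ≡ L (inv x)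

  open Aut⁺

  _≈ᴬ_ : ∀ {ω} → Aut⁺ ω → Aut⁺ ω → Set
  φ ≈ᴬ ψ = ∀ x → IsDart x → fun φ x ≡ fun ψ x

  _∙ᴬ_ : ∀ {ω} → Aut⁺ ω → Aut⁺ ω → Aut⁺ ω
  _∙ᴬ_ {ω} φ ψ = record
    { fun = λ x → fun φ (fun ψ x)
    ; inv = λ x → inv ψ (inv φ x)
    ; fun-dart = λ x dx → fun-dart φ _ (fun-dart ψ x dx)
    ; inv-dart = λ x dx → inv-dart ψ _ (inv-dart φ x dx)
    ; inv-fun = λ x dx → trans′ (cong′ (inv ψ) (inv-fun φ _ (fun-dart ψ x dx))) (inv-fun ψ x dx)
    ; fun-inv = λ x dx → trans′ (cong′ (fun φ) (fun-inv ψ _ (inv-dart φ x dx))) (fun-inv φ x dx)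
    ; comm-R = λ x dx → trans′ (cong′ (fun φ) (comm-R ψ x dx)) (comm-R φ _ (fun-dart ψ x dx))
    ; comm-L = λ x dx → trans′ (cong′ (fun φ) (comm-L ψ x dx)) (comm-L φ _ (fun-dart ψ x dx))
    ; inv-comm-R = λ x dx → trans′ (cong′ (inv ψ) (inv-comm-R φ x dx)) (inv-comm-R ψ _ (inv-dart φ x dx))
    ; inv-comm-L = λ x dx → trans′ (cong′ (inv ψ) (inv-comm-L φ x dx)) (inv-comm-L ψ _ (inv-dart φ x dx))
    }
    where
    open import Relation.Binary.PropositionalEquality using ()
      renaming (trans to trans′; cong to cong′)

  εᴬ : ∀ {ω} → Aut⁺ ω
  εᴬ = record
    { fun = λ x → x ; inv = λ x → x
    ; fun-dart = λ _ dx → dx ; inv-dart = λ _ dx → dx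
    ; inv-fun = λ _ _ → refl′ ; fun-inv = λ _ _ → refl′
    ; comm-R = λ _ _ → refl′ ; comm-L = λ _ _ → refl′
    ; inv-comm-R = λ _ _ → refl′ ; inv-comm-L = λ _ _ → refl′ }
    where
    open import Relation.Binary.PropositionalEquality using () renaming (refl to refl′)

  _⁻¹ᴬ : ∀ {ω} → Aut⁺ ω → Aut⁺ ω
  φ ⁻¹ᴬ = record
    { fun = inv φ ; inv = fun φ
    ; fun-dart = inv-dart φ ; inv-dart = fun-dart φ
    ; inv-fun = fun-inv φ ; fun-inv = inv-fun φ
    ; comm-R = inv-comm-R φ ; comm-L = inv-comm-L φ
    ; inv-comm-R = comm-R φ ; inv-comm-L = comm-L φ }

  Aut⁺-RawGroup : Carrier → RawGroup 0ℓ 0ℓ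
  Aut⁺-RawGroup ω = record
    { Carrier = Aut⁺ ω
    ; _≈_ = _≈ᴬ_
    ; _∙_ = _∙ᴬ_
    ; ε = εᴬ
    ; _⁻¹ = _⁻¹ᴬ }

-- Label the neighbours of a vertex by t ↦ e₁M_ω^t = ω^⌊t/d⌋ e_(t mod d), so that the rotation of
-- H(d, ω) becomes t ↦ t + 1 and has period d e whenever ωᵉ = 1. Write ω = ω′ᴶ, where ω′ᵉ = 1 and
-- gcd(J, e) = 1, and choose u ≡ J (mod e) invertible modulo d e. The monomial linear map A with
-- A(e₁M_ω^t) = e₁M_ω′^(u t) commutes with dart reversal, being additive, and turns the rotation of
-- H(d, ω) into the u-th power of that of H(d, ω′); as u is a unit modulo d e, the rotation of H(d, ω′)
-- is conversely a power of the transported one. So conjugation by A is an isomorphism of the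
-- groups of orientation-preserving automorphisms.

module Submission where

open import Defs
open import Level using (0ℓ)
open import Data.Nat as ℕ using (ℕ; zero; suc; _+_; _*_; _≤_; NonZero)
import Data.Nat.Properties as ℕ
open import Data.Nat.DivMod using (_/_; _mod_)
open import Data.Nat.Tactic.RingSolver using (solve-∀)
open import Data.Fin as Fin using (Fin; toℕ)
open import Data.Fin.Properties using (toℕ-injective; toℕ<n; suc-injective; toℕ-fromℕ<)
open import Data.Fin.Permutation using (Permutation′; _⟨$⟩ʳ_; _⟨$⟩ˡ_; inverseˡ; inverseʳ; flip)
open import Data.Vec using (Vec; []; _∷_; tabulate; lookup; zipWith; foldr)
open import Data.Vec.Properties using (lookup∘tabulate; lookup-zipWith; lookup-map)
open import Data.Vec.Relation.Binary.Pointwise.Extensional using (ext; Pointwise-≡⇒≡)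
open import Data.Product using (∃; ∃-syntax; _×_; _,_; proj₁; proj₂)
open import Data.Empty using (⊥-elim)
open import Relation.Nullary using (¬_; yes; no)
open import Relation.Binary.PropositionalEquality
open import Function using (_∘_)
open import Algebra.Bundles using (CommutativeRing)
open import Algebra.Morphism.Structures using (module GroupMorphisms)

module Arithmetic where

  open import Data.Nat using (_∸_; _<_; z≤n; s≤s; s≤s⁻¹; ≢-nonZero⁻¹; >-nonZero⁻¹)
  open import Data.Nat.Properties
  open import Data.Nat.Divisibility
  open import Data.Nat.DivMod
  open import Data.Nat.Coprimality using (Coprime; coprime?; coprime-Bézout)
  open import Data.Nat.GCD using (module Bézout)
  open import Data.Nat.Primality using (Prime; euclidsLemma; prime⇒irreducible; prime⇒nonZero; ¬prime[1])
  open import Data.Nat.Primality.Factorisation using (factorise; PrimeFactorisation)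
  open import Data.Nat.ListAction using (product)
  open import Data.List using ([]; _∷_)
  open import Data.List.Relation.Unary.All using (All; []; _∷_)
  open import Data.Product using (∃₂)
  open import Data.Sum using (inj₁; inj₂)
  open import Data.Empty using (⊥)
  open import Data.Fin.Permutation using (permutation)

  prime∤1 : ∀ {p} → Prime p → ¬ p ∣ 1
  prime∤1 p-prime p∣1 = ¬prime[1] (subst Prime (∣1⇒≡1 p∣1) p-prime)

  prime-divisor : ∀ n → 1 < n → ∃[ p ] Prime p × p ∣ n
  prime-divisor n@(suc _) 1<n = divisorIn factors isFactorisation factorsPrime
    where
    open PrimeFactorisation (factorise n)
    divisorIn : ∀ ps → n ≡ product ps → All Prime ps → ∃[ p ] Prime p × p ∣ n
    divisorIn []       n≡1 _            = ⊥-elim (<-irrefl (sym n≡1) 1<n)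
    divisorIn (p ∷ ps) n≡p* (p-prime ∷ _) = p , p-prime , subst (p ∣_) (sym n≡p*) (m∣m*n (product ps))

  coprime-by-primes : ∀ {m n} .{{_ : NonZero n}} → (∀ {p} → Prime p → p ∣ m → p ∣ n → ⊥) → Coprime m n
  coprime-by-primes {n = n} _ {zero} (_ , 0∣n) = ⊥-elim (≢-nonZero⁻¹ n (0∣⇒≡0 0∣n))
  coprime-by-primes _ {suc zero} _ = refl
  coprime-by-primes no-common {i@(suc (suc _))} (i∣m , i∣n) with prime-divisor i (s≤s (s≤s z≤n))
  ... | p , p-prime , p∣i = ⊥-elim (no-common p-prime (∣-trans p∣i i∣m) (∣-trans p∣i i∣n))

  *≡suc⇒coprime : ∀ m k e → m * k ≡ suc e → Coprime m e
  *≡suc⇒coprime m k e mk≡1+e {i} (i∣m , i∣e) =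
    ∣1⇒≡1 (∣m+n∣m⇒∣n (subst (i ∣_) (trans mk≡1+e (+-comm 1 e)) (∣m⇒∣m*n k i∣m)) i∣e)

  coprimeProduct : ℕ → ℕ → ℕ
  coprimeProduct a zero = 1
  coprimeProduct a (suc n) with coprime? (suc n) a
  ... | yes _ = suc n * coprimeProduct a n
  ... | no  _ = coprimeProduct a n

  ∣coprimeProduct : ∀ a n x → 1 ≤ x → x ≤ n → Coprime x a → x ∣ coprimeProduct a n
  ∣coprimeProduct a zero (suc _) _ () _
  ∣coprimeProduct a (suc n) x 1≤x x≤1+n x⊥a with coprime? (suc n) a | m≤n⇒m<n∨m≡n x≤1+n
  ... | yes _    | inj₂ refl = m∣m*n (coprimeProduct a n)
  ... | no ¬1+n⊥a | inj₂ refl = ⊥-elim (¬1+n⊥a x⊥a)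
  ... | yes _    | inj₁ x≤n = ∣n⇒∣m*n (suc n) (∣coprimeProduct a n x 1≤x (s≤s⁻¹ x≤n) x⊥a)
  ... | no _     | inj₁ x≤n = ∣coprimeProduct a n x 1≤x (s≤s⁻¹ x≤n) x⊥a

  prime∣coprimeProduct⇒∤ : ∀ a n {p} → Prime p → p ∣ coprimeProduct a n → ¬ p ∣ a
  prime∣coprimeProduct⇒∤ a zero    p-prime p∣1 _ = prime∤1 p-prime p∣1
  prime∣coprimeProduct⇒∤ a (suc n) {p} p-prime p∣P p∣a with coprime? (suc n) a
  ... | no _ = prime∣coprimeProduct⇒∤ a n p-prime p∣P p∣a
  ... | yes 1+n⊥a with euclidsLemma (suc n) (coprimeProduct a n) p-prime p∣P
  ...   | inj₁ p∣1+n = prime∤1 p-prime (subst (p ∣_) (1+n⊥a (p∣1+n , p∣a)) ∣-refl)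
  ...   | inj₂ p∣P′  = prime∣coprimeProduct⇒∤ a n p-prime p∣P′ p∣a

  -- A prime factor of n dividing a divides neither b nor t; one coprime to a is a factor of t.
  coprime-shift : ∀ a b n .{{_ : NonZero n}} → Coprime a b → Coprime (a + b * coprimeProduct a n) n
  coprime-shift a b n a⊥b = coprime-by-primes no-common
    where
    t = coprimeProduct a n
    no-common : ∀ {p} → Prime p → p ∣ a + b * t → p ∣ n → ⊥
    no-common {p} p-prime p∣u p∣n with p ∣? a
    ... | yes p∣a with euclidsLemma b t p-prime (∣m+n∣m⇒∣n p∣u p∣a)
    ...   | inj₁ p∣b = prime∤1 p-prime (subst (p ∣_) (a⊥b (p∣a , p∣b)) ∣-refl)
    ...   | inj₂ p∣t = prime∣coprimeProduct⇒∤ a n p-prime p∣t p∣a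
    no-common {p} p-prime p∣u p∣n | no p∤a = p∤a (∣m+n∣m⇒∣n (subst (p ∣_) (+-comm a (b * t)) p∣u) p∣bt)
      where
      p⊥a : Coprime p a
      p⊥a (i∣p , i∣a) with prime⇒irreducible p-prime i∣p
      ... | inj₁ i≡1    = i≡1
      ... | inj₂ refl = ⊥-elim (p∤a i∣a)
      p∣bt : p ∣ b * t
      p∣bt = ∣n⇒∣m*n b (∣coprimeProduct a n p (>-nonZero⁻¹ p {{prime⇒nonZero p-prime}}) (∣⇒≤ p∣n) p⊥a)

  coprime⇒inverse : ∀ u n .{{_ : NonZero u}} → Coprime u n → ∃₂ λ u′ y → u * u′ ≡ 1 + y * n
  coprime⇒inverse u n u⊥n with coprime-Bézout u⊥n
  ... | Bézout.+- x y 1+yn≡xu = x , y , trans (*-comm u x) (sym 1+yn≡xu)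
  ... | Bézout.-+ x y 1+xu≡yn = inverse n y 1+xu≡yn
    where
    -- From 1 + x u = y n, multiplying by n - 1 gives u · x (n - 1) ≡ 1 (mod n).
    inverse : ∀ n y → 1 + x * u ≡ y * n → ∃₂ λ u′ y′ → u * u′ ≡ 1 + y′ * n
    inverse zero          y       1+xu≡0 = ⊥-elim (1+n≢0 (trans 1+xu≡0 (*-zeroʳ y)))
    inverse (suc zero)    _       _      = 1 , u ∸ 1 , trans (*-identityʳ u) (sym (trans (cong (1 +_) (*-identityʳ (u ∸ 1))) (m+[n∸m]≡n (>-nonZero⁻¹ u))))
    inverse (suc (suc m)) zero    ()
    inverse (suc (suc m)) (suc y) 1+xu≡yn = x * suc m , y * suc m + m , +-cancelʳ-≡ (2 + m) _ _ (begin
      u * (x * suc m) + (2 + m)                 ≡⟨ lhs u x m ⟩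
      (1 + x * u) * suc m + 1                   ≡⟨ cong (λ k → k * suc m + 1) 1+xu≡yn ⟩
      suc y * (2 + m) * suc m + 1               ≡⟨ rhs y m ⟩
      1 + (y * suc m + m) * (2 + m) + (2 + m)   ∎)
      where
      open ≡-Reasoning
      lhs : ∀ u x m → u * (x * suc m) + (2 + m) ≡ (1 + x * u) * suc m + 1
      lhs = solve-∀
      rhs : ∀ y m → suc y * (2 + m) * suc m + 1 ≡ 1 + (y * suc m + m) * (2 + m) + (2 + m)
      rhs = solve-∀


  *-%-absorbʳ : ∀ m n d .{{_ : NonZero d}} → (m * (n % d)) % d ≡ (m * n) % d
  *-%-absorbʳ m n d = begin
    (m * (n % d)) % d          ≡⟨ %-distribˡ-* m (n % d) d ⟩
    (m % d * (n % d % d)) % d  ≡⟨ cong (λ k → (m % d * k) % d) (m%n%n≡m%n n d) ⟩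
    (m % d * (n % d)) % d      ≡⟨ %-distribˡ-* m n d ⟨
    (m * n) % d                ∎
    where open ≡-Reasoning

  mod-*-inverse : ∀ {n} .{{_ : NonZero n}} a b z → a * b ≡ 1 + z * n →
                  (i : Fin n) → (b * toℕ ((a * toℕ i) mod n)) mod n ≡ i
  mod-*-inverse {n} a b z ab≡1+zn i = toℕ-injective (begin
    toℕ ((b * toℕ ((a * i′) mod n)) mod n)   ≡⟨ toℕ-fromℕ< _ ⟩
    (b * toℕ ((a * i′) mod n)) % n           ≡⟨ cong (λ k → (b * k) % n) (toℕ-fromℕ< _) ⟩
    (b * ((a * i′) % n)) % n                 ≡⟨ *-%-absorbʳ b (a * i′) n ⟩
    (b * (a * i′)) % n                       ≡⟨ cong (_% n) (ba·i≡i+zi·n) ⟩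
    (i′ + z * i′ * n) % n                    ≡⟨ [m+kn]%n≡m%n i′ (z * i′) n ⟩
    i′ % n                                   ≡⟨ m<n⇒m%n≡m (toℕ<n i) ⟩
    i′                                       ∎)
    where
    open ≡-Reasoning
    i′ = toℕ i
    ba·i≡i+zi·n : b * (a * i′) ≡ i′ + z * i′ * n
    ba·i≡i+zi·n = begin
      b * (a * i′)       ≡⟨ *-assoc b a i′ ⟨
      b * a * i′         ≡⟨ cong (_* i′) (trans (*-comm b a) ab≡1+zn) ⟩
      (1 + z * n) * i′   ≡⟨ expand z n i′ ⟩
      i′ + z * i′ * n    ∎
      where
      expand : ∀ z n i → (1 + z * n) * i ≡ i + z * i * n
      expand = solve-∀

  *-permutation : ∀ {n} .{{_ : NonZero n}} a b z → a * b ≡ 1 + z * n → Permutation′ n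
  *-permutation {n} a b z ab≡1+zn = permutation (λ i → (a * toℕ i) mod n) (λ k → (b * toℕ k) mod n)
    (mod-*-inverse b a z (trans (*-comm b a) ab≡1+zn)) (mod-*-inverse a b z ab≡1+zn)

  divMod-property : ∀ t n .{{_ : NonZero n}} → t ≡ toℕ (t mod n) + t / n * n
  divMod-property t n = DivMod.property (t divMod n)

  divMod-unique : ∀ {t n} .{{_ : NonZero n}} a (r : Fin n) → t ≡ toℕ r + a * n → t / n ≡ a × t mod n ≡ r
  divMod-unique {n = n} a r refl = t/n≡a , t%n≡r
    where
    t/n≡a : (toℕ r + a * n) / n ≡ a
    t/n≡a = trans (+-distrib-/-∣ʳ (toℕ r) (n∣m*n a)) (cong₂ _+_ (m<n⇒m/n≡0 (toℕ<n r)) (m*n/n≡m a n))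
    t%n≡r : (toℕ r + a * n) mod n ≡ r
    t%n≡r = toℕ-injective (trans (toℕ-fromℕ< _) (trans ([m+kn]%n≡m%n (toℕ r) a n) (m<n⇒m%n≡m (toℕ<n r))))

open Arithmetic

-- Lets `rewrite` expose the entries of a tabulated vector whose generating function, local
-- to a where-clause in Defs, cannot be named.
lookup-tabulated : ∀ {A : Set} {n} (v : Vec A n) {f : Fin n → A} → v ≡ tabulate f → ∀ j → lookup v j ≡ f j
lookup-tabulated _ refl = lookup∘tabulate _

vec-ext : ∀ {A : Set} {n} {v w : Vec A n} → (∀ j → lookup v j ≡ lookup w j) → v ≡ w
vec-ext = Pointwise-≡⇒≡ ∘ ext

module _ {q : ℕ} (F : FiniteField q) where

  open FiniteField F renaming (_+_ to _⊕_; _*_ to _⊗_)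

  ring : CommutativeRing 0ℓ 0ℓ
  ring = record { isCommutativeRing = isCommutativeRing }

  open CommutativeRing ring using (+-identityˡ; +-identityʳ; *-identityˡ; *-identityʳ; zeroˡ; zeroʳ; *-comm; *-assoc; distribˡ)
  open import Algebra.Properties.Ring (CommutativeRing.ring ring) using (-‿distribʳ-*)
  open import Algebra.Properties.Semiring.Exp (CommutativeRing.semiring ring) using (_^_; ^-homo-*; ^-assocʳ)

  pow≡^ : ∀ x n → pow x n ≡ x ^ n
  pow≡^ x zero    = refl
  pow≡^ x (suc n) = cong (x ⊗_) (pow≡^ x n)

  1^n≡1 : ∀ n → 1# ^ n ≡ 1#
  1^n≡1 zero    = refl
  1^n≡1 (suc n) = trans (*-identityˡ _) (1^n≡1 n)

  *-cancelˡ-nonzero : ∀ {x y z} → ¬ x ≡ 0# → x ⊗ y ≡ x ⊗ z → y ≡ z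
  *-cancelˡ-nonzero {x} {y} {z} x≢0 xy≡xz with inverse x x≢0
  ... | x⁻¹ , xx⁻¹≡1 = begin
    y                ≡⟨ sym (*-identityˡ y) ⟩
    1# ⊗ y           ≡⟨ cong (_⊗ y) x⁻¹x≡1 ⟨
    (x⁻¹ ⊗ x) ⊗ y    ≡⟨ *-assoc x⁻¹ x y ⟩
    x⁻¹ ⊗ (x ⊗ y)    ≡⟨ cong (x⁻¹ ⊗_) xy≡xz ⟩
    x⁻¹ ⊗ (x ⊗ z)    ≡⟨ *-assoc x⁻¹ x z ⟨
    (x⁻¹ ⊗ x) ⊗ z    ≡⟨ cong (_⊗ z) x⁻¹x≡1 ⟩
    1# ⊗ z           ≡⟨ *-identityˡ z ⟩
    z                ∎
    where
    open ≡-Reasoning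
    x⁻¹x≡1 : x⁻¹ ⊗ x ≡ 1#
    x⁻¹x≡1 = trans (*-comm x⁻¹ x) xx⁻¹≡1

  *-nonzero : ∀ {x y} → ¬ x ≡ 0# → ¬ y ≡ 0# → ¬ x ⊗ y ≡ 0#
  *-nonzero {x} x≢0 y≢0 xy≡0 = y≢0 (*-cancelˡ-nonzero x≢0 (trans xy≡0 (sym (zeroʳ x))))

  ^-nonzero : ∀ {x} n → ¬ x ≡ 0# → ¬ x ^ n ≡ 0#
  ^-nonzero zero    _   1≡0 = 0≢1 (sym 1≡0)
  ^-nonzero (suc n) x≢0     = *-nonzero x≢0 (^-nonzero n x≢0)

  ^≡1⇒^*≡1 : ∀ {x} e → x ^ e ≡ 1# → ∀ k → x ^ (e * k) ≡ 1#
  ^≡1⇒^*≡1 {x} e x^e≡1 k = trans (sym (^-assocʳ x e k)) (trans (cong (_^ k) x^e≡1) (1^n≡1 k))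

  module _ (d : ℕ) where

    open Hamming F d
    open Aut⁺
    open import Function.Endo.Propositional Pair using () renaming (_^_ to _^ᵉ_)

    lookup-scaledBasis-≡ : ∀ c i → lookup (scaledBasis c i) i ≡ c
    lookup-scaledBasis-≡ c i rewrite lookup-tabulated (scaledBasis c i) refl i with i Fin.≟ i
    ... | yes _   = refl
    ... | no i≢i = ⊥-elim (i≢i refl)

    lookup-scaledBasis-≢ : ∀ c {i j} → ¬ i ≡ j → lookup (scaledBasis c i) j ≡ 0#
    lookup-scaledBasis-≢ c {i} {j} i≢j rewrite lookup-tabulated (scaledBasis c i) refl j with i Fin.≟ j
    ... | yes i≡j = ⊥-elim (i≢j i≡j)
    ... | no _    = refl

    ≡scaledBasis : ∀ {v c i} → lookup v i ≡ c → (∀ j → ¬ i ≡ j → lookup v j ≡ 0#) → v ≡ scaledBasis c i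
    ≡scaledBasis {v} {c} {i} vᵢ≡c v-vanishes = vec-ext λ j → entry j
      where
      entry : ∀ j → lookup v j ≡ lookup (scaledBasis c i) j
      entry j with i Fin.≟ j
      ... | yes refl = trans vᵢ≡c (sym (lookup-scaledBasis-≡ c i))
      ... | no i≢j   = trans (v-vanishes j i≢j) (sym (lookup-scaledBasis-≢ c i≢j))

    -- s ·ₘ M ≡ tabulate (combination s M) holds definitionally.
    combination : ∀ {m} → Vec Carrier m → Vec V m → Fin d → Carrier
    combination s M j = foldr (λ _ → Carrier) _⊕_ 0# (zipWith (λ sᵢ row → sᵢ ⊗ lookup row j) s M)

    combination-zero : ∀ {m} (s : Vec Carrier m) M j → (∀ k → lookup s k ≡ 0#) → combination s M j ≡ 0#
    combination-zero []      []      j _  = refl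
    combination-zero (x ∷ s) (r ∷ M) j s≡0
      rewrite s≡0 Fin.zero | zeroˡ (lookup r j) | combination-zero s M j (s≡0 ∘ Fin.suc) = +-identityʳ 0#

    combination-single : ∀ {m} (s : Vec Carrier m) M j i → (∀ k → ¬ k ≡ i → lookup s k ≡ 0#) →
                         combination s M j ≡ lookup s i ⊗ lookup (lookup M i) j
    combination-single (x ∷ s) (r ∷ M) j Fin.zero s-vanishes
      rewrite combination-zero s M j (λ k → s-vanishes (Fin.suc k) λ ()) = +-identityʳ _
    combination-single (x ∷ s) (r ∷ M) j (Fin.suc i) s-vanishes
      rewrite s-vanishes Fin.zero (λ ()) | zeroˡ (lookup r j)
            | combination-single s M j i (λ k k≢i → s-vanishes (Fin.suc k) (k≢i ∘ suc-injective)) = +-identityˡ _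

    scaledBasis-·ₘ : ∀ {M i} c a j → lookup M i ≡ scaledBasis a j → scaledBasis c i ·ₘ M ≡ scaledBasis (c ⊗ a) j
    scaledBasis-·ₘ {M} {i} c a j Mᵢ≡aeⱼ =
      ≡scaledBasis (trans (entry j) (cong (c ⊗_) (lookup-scaledBasis-≡ a j)))
                   (λ k j≢k → trans (entry k) (trans (cong (c ⊗_) (lookup-scaledBasis-≢ a j≢k)) (zeroʳ c)))
      where
      open ≡-Reasoning
      entry : ∀ k → lookup (scaledBasis c i ·ₘ M) k ≡ c ⊗ lookup (scaledBasis a j) k
      entry k = begin
        lookup (scaledBasis c i ·ₘ M) k                     ≡⟨ lookup∘tabulate _ k ⟩
        combination (scaledBasis c i) M k                   ≡⟨ combination-single (scaledBasis c i) M k i (λ l l≢i → lookup-scaledBasis-≢ c (l≢i ∘ sym)) ⟩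
        lookup (scaledBasis c i) i ⊗ lookup (lookup M i) k  ≡⟨ cong₂ (λ x row → x ⊗ lookup row k) (lookup-scaledBasis-≡ c i) Mᵢ≡aeⱼ ⟩
        c ⊗ lookup (scaledBasis a j) k                      ∎

    private
      Mω-entry : Carrier → Fin d → Fin d → Carrier
      Mω-entry w i j = lookup (lookup (Mω w) i) j

    Mω-entry-next : ∀ w i j → toℕ j ≡ suc (toℕ i) → Mω-entry w i j ≡ 1#
    Mω-entry-next w i j j≡1+i rewrite lookup-tabulated (lookup (Mω w) i) (lookup-tabulated (Mω w) refl i) j
      with toℕ j ℕ.≟ suc (toℕ i)
    ... | yes _    = refl
    ... | no j≢1+i = ⊥-elim (j≢1+i j≡1+i)

    Mω-entry-last : ∀ w i j → suc (toℕ i) ≡ d → toℕ j ≡ 0 → Mω-entry w i j ≡ w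
    Mω-entry-last w i j 1+i≡d j≡0 rewrite lookup-tabulated (lookup (Mω w) i) (lookup-tabulated (Mω w) refl i) j
      with toℕ j ℕ.≟ suc (toℕ i)
    ... | yes j≡1+i = ⊥-elim (ℕ.1+n≢0 (trans (sym j≡1+i) j≡0))
    ... | no _ with suc (toℕ i) ℕ.≟ d | toℕ j ℕ.≟ 0
    ...   | yes _     | yes _   = refl
    ...   | no 1+i≢d  | _       = ⊥-elim (1+i≢d 1+i≡d)
    ...   | yes _     | no j≢0  = ⊥-elim (j≢0 j≡0)

    Mω-entry-other : ∀ w i j → ¬ toℕ j ≡ suc (toℕ i) → ¬ (suc (toℕ i) ≡ d × toℕ j ≡ 0) → Mω-entry w i j ≡ 0#
    Mω-entry-other w i j j≢1+i ¬last rewrite lookup-tabulated (lookup (Mω w) i) (lookup-tabulated (Mω w) refl i) j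
      with toℕ j ℕ.≟ suc (toℕ i)
    ... | yes j≡1+i = ⊥-elim (j≢1+i j≡1+i)
    ... | no _ with suc (toℕ i) ℕ.≟ d | toℕ j ℕ.≟ 0
    ...   | yes 1+i≡d | yes j≡0 = ⊥-elim (¬last (1+i≡d , j≡0))
    ...   | no _      | _       = refl
    ...   | yes _     | no _    = refl

    Mω-row-next : ∀ w i j → toℕ j ≡ suc (toℕ i) → lookup (Mω w) i ≡ scaledBasis 1# j
    Mω-row-next w i j j≡1+i = ≡scaledBasis (Mω-entry-next w i j j≡1+i) λ k j≢k →
      Mω-entry-other w i k (λ k≡1+i → j≢k (toℕ-injective (trans j≡1+i (sym k≡1+i))))
                           (λ (1+i≡d , _) → ℕ.<⇒≢ (toℕ<n j) (trans j≡1+i 1+i≡d))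

    Mω-row-last : ∀ w i j → suc (toℕ i) ≡ d → toℕ j ≡ 0 → lookup (Mω w) i ≡ scaledBasis w j
    Mω-row-last w i j 1+i≡d j≡0 = ≡scaledBasis (Mω-entry-last w i j 1+i≡d j≡0) λ k j≢k →
      Mω-entry-other w i k (λ k≡1+i → ℕ.<⇒≢ (toℕ<n k) (trans k≡1+i 1+i≡d))
                           (λ (_ , k≡0) → j≢k (toℕ-injective (trans j≡0 (sym k≡0))))

    monomial : Permutation′ d → (Fin d → Carrier) → V → V
    monomial π a v = tabulate λ k → a (π ⟨$⟩ˡ k) ⊗ lookup v (π ⟨$⟩ˡ k)

    module _ (π : Permutation′ d) (a : Fin d → Carrier) where

      private
        lookup-monomial : ∀ v k → lookup (monomial π a v) k ≡ a (π ⟨$⟩ˡ k) ⊗ lookup v (π ⟨$⟩ˡ k)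
        lookup-monomial v = lookup∘tabulate _

      monomial-+ᵥ : ∀ v w → monomial π a (v +ᵥ w) ≡ monomial π a v +ᵥ monomial π a w
      monomial-+ᵥ v w = vec-ext λ k → let i = π ⟨$⟩ˡ k in begin
        lookup (monomial π a (v +ᵥ w)) k                   ≡⟨ lookup-monomial (v +ᵥ w) k ⟩
        a i ⊗ lookup (v +ᵥ w) i                           ≡⟨ cong (a i ⊗_) (lookup-zipWith _⊕_ i v w) ⟩
        a i ⊗ (lookup v i ⊕ lookup w i)                   ≡⟨ distribˡ (a i) _ _ ⟩
        a i ⊗ lookup v i ⊕ a i ⊗ lookup w i               ≡⟨ cong₂ _⊕_ (lookup-monomial v k) (lookup-monomial w k) ⟨
        lookup (monomial π a v) k ⊕ lookup (monomial π a w) k ≡⟨ lookup-zipWith _⊕_ k (monomial π a v) (monomial π a w) ⟨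
        lookup (monomial π a v +ᵥ monomial π a w) k       ∎
        where open ≡-Reasoning

      monomial-‿ : ∀ v → monomial π a (-ᵥ v) ≡ -ᵥ monomial π a v
      monomial-‿ v = vec-ext λ k → let i = π ⟨$⟩ˡ k in begin
        lookup (monomial π a (-ᵥ v)) k     ≡⟨ lookup-monomial (-ᵥ v) k ⟩
        a i ⊗ lookup (-ᵥ v) i              ≡⟨ cong (a i ⊗_) (lookup-map i -_ v) ⟩
        a i ⊗ (- lookup v i)               ≡⟨ -‿distribʳ-* (a i) _ ⟨
        - (a i ⊗ lookup v i)               ≡⟨ cong -_ (lookup-monomial v k) ⟨
        - lookup (monomial π a v) k        ≡⟨ lookup-map k -_ (monomial π a v) ⟨
        lookup (-ᵥ monomial π a v) k       ∎
        where open ≡-Reasoning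

      monomial-scaledBasis : ∀ c i → monomial π a (scaledBasis c i) ≡ scaledBasis (a i ⊗ c) (π ⟨$⟩ʳ i)
      monomial-scaledBasis c i = ≡scaledBasis
        (trans (lookup-monomial (scaledBasis c i) (π ⟨$⟩ʳ i))
               (trans (cong (λ j → a j ⊗ lookup (scaledBasis c i) j) (inverseˡ π)) (cong (a i ⊗_) (lookup-scaledBasis-≡ c i))))
        (λ k πi≢k → trans (lookup-monomial (scaledBasis c i) k)
               (trans (cong (a (π ⟨$⟩ˡ k) ⊗_) (lookup-scaledBasis-≢ c λ i≡π⁻¹k → πi≢k (trans (cong (π ⟨$⟩ʳ_) i≡π⁻¹k) (inverseʳ π))))
                      (zeroʳ _)))

      monomial-inverse : ∀ b → (∀ i → b (π ⟨$⟩ʳ i) ⊗ a i ≡ 1#) → ∀ v → monomial (flip π) b (monomial π a v) ≡ v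
      monomial-inverse b ba≡1 v = vec-ext λ i → begin
        lookup (monomial (flip π) b (monomial π a v)) i                 ≡⟨ lookup∘tabulate _ i ⟩
        b (π ⟨$⟩ʳ i) ⊗ lookup (monomial π a v) (π ⟨$⟩ʳ i)               ≡⟨ cong (b (π ⟨$⟩ʳ i) ⊗_) (lookup-monomial v _) ⟩
        b (π ⟨$⟩ʳ i) ⊗ (a (π ⟨$⟩ˡ (π ⟨$⟩ʳ i)) ⊗ lookup v (π ⟨$⟩ˡ (π ⟨$⟩ʳ i))) ≡⟨ cong (λ j → b (π ⟨$⟩ʳ i) ⊗ (a j ⊗ lookup v j)) (inverseˡ π) ⟩
        b (π ⟨$⟩ʳ i) ⊗ (a i ⊗ lookup v i)                               ≡⟨ *-assoc _ _ _ ⟨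
        (b (π ⟨$⟩ʳ i) ⊗ a i) ⊗ lookup v i                               ≡⟨ cong (_⊗ lookup v i) (ba≡1 i) ⟩
        1# ⊗ lookup v i                                                 ≡⟨ *-identityˡ _ ⟩
        lookup v i                                                      ∎
        where open ≡-Reasoning

    record DartBijection : Set where
      field
        to from   : Pair → Pair
        to-dart   : ∀ x → IsDart x → IsDart (to x)
        from-dart : ∀ x → IsDart x → IsDart (from x)
        from-to   : ∀ x → IsDart x → from (to x) ≡ x
        to-from   : ∀ x → IsDart x → to (from x) ≡ x
        to-L      : ∀ x → IsDart x → to (L x) ≡ L (to x)
        from-L    : ∀ x → IsDart x → from (L x) ≡ L (from x)

    invert : DartBijection → DartBijection
    invert T = record
      { to = from ; from = to ; to-dart = from-dart ; from-dart = to-dart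
      ; from-to = to-from ; to-from = from-to ; to-L = from-L ; from-L = to-L }
      where open DartBijection T

    identityBijection : DartBijection
    identityBijection = record
      { to = λ x → x ; from = λ x → x ; to-dart = λ _ x-dart → x-dart ; from-dart = λ _ x-dart → x-dart
      ; from-to = λ _ _ → refl ; to-from = λ _ _ → refl ; to-L = λ _ _ → refl ; from-L = λ _ _ → refl }

    module _ (π : Permutation′ d) (a : Fin d → Carrier) (a≢0 : ∀ i → ¬ a i ≡ 0#) where

      private
        a⁻¹ : Fin d → Carrier
        a⁻¹ i = proj₁ (inverse (a i) (a≢0 i))

        aa⁻¹≡1 : ∀ i → a i ⊗ a⁻¹ i ≡ 1#
        aa⁻¹≡1 i = proj₂ (inverse (a i) (a≢0 i))

        b : Fin d → Carrier
        b k = a⁻¹ (π ⟨$⟩ˡ k)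

        b≢0 : ∀ k → ¬ b k ≡ 0#
        b≢0 k b≡0 = 0≢1 (trans (sym (zeroʳ _)) (trans (cong (a (π ⟨$⟩ˡ k) ⊗_) (sym b≡0)) (aa⁻¹≡1 _)))

      monomialBijection : DartBijection
      monomialBijection = record
        { to        = λ (v , s) → monomial π a v , monomial π a s
        ; from      = λ (v , s) → monomial (flip π) b v , monomial (flip π) b s
        ; to-dart   = λ { (v , s) (i , c , c≢0 , s≡ceᵢ) →
                          π ⟨$⟩ʳ i , a i ⊗ c , *-nonzero (a≢0 i) c≢0 , trans (cong (monomial π a) s≡ceᵢ) (monomial-scaledBasis π a c i) }
        ; from-dart = λ { (v , s) (i , c , c≢0 , s≡ceᵢ) →
                          π ⟨$⟩ˡ i , b i ⊗ c , *-nonzero (b≢0 i) c≢0 , trans (cong (monomial (flip π) b) s≡ceᵢ) (monomial-scaledBasis (flip π) b c i) }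
        ; from-to   = λ (v , s) _ → cong₂ _,_ (monomial-inverse π a b ba≡1 v) (monomial-inverse π a b ba≡1 s)
        ; to-from   = λ (v , s) _ → cong₂ _,_ (monomial-inverse (flip π) b a ab≡1 v) (monomial-inverse (flip π) b a ab≡1 s)
        ; to-L      = λ (v , s) _ → cong₂ _,_ (monomial-+ᵥ π a v s) (monomial-‿ π a s)
        ; from-L    = λ (v , s) _ → cong₂ _,_ (monomial-+ᵥ (flip π) b v s) (monomial-‿ (flip π) b s)
        }
        where
        ba≡1 : ∀ i → b (π ⟨$⟩ʳ i) ⊗ a i ≡ 1#
        ba≡1 i = trans (cong (λ j → a⁻¹ j ⊗ a i) (inverseˡ π)) (trans (*-comm _ _) (aa⁻¹≡1 i))
        ab≡1 : ∀ k → a (π ⟨$⟩ˡ k) ⊗ b k ≡ 1#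
        ab≡1 k = aa⁻¹≡1 (π ⟨$⟩ˡ k)

    IsomorphicAut⁺ : Carrier → Carrier → Set
    IsomorphicAut⁺ w w′ = ∃ λ (Φ : Aut⁺ w → Aut⁺ w′) → GroupMorphisms.IsGroupIsomorphism (Aut⁺-RawGroup w) (Aut⁺-RawGroup w′) Φ

    module _ {w : Carrier} (R-dart : ∀ x → IsDart x → IsDart (R w x)) where

      Rⁿ-dart : ∀ n x → IsDart x → IsDart ((R w ^ᵉ n) x)
      Rⁿ-dart zero    x x-dart = x-dart
      Rⁿ-dart (suc n) x x-dart = R-dart ((R w ^ᵉ n) x) (Rⁿ-dart n x x-dart)

      fun-Rⁿ : ∀ (φ : Aut⁺ w) n x → IsDart x → fun φ ((R w ^ᵉ n) x) ≡ (R w ^ᵉ n) (fun φ x)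
      fun-Rⁿ φ zero    x x-dart = refl
      fun-Rⁿ φ (suc n) x x-dart = trans (comm-R φ _ (Rⁿ-dart n x x-dart)) (cong (R w) (fun-Rⁿ φ n x x-dart))

    module Conjugation {w w′ : Carrier} (R-dart : ∀ x → IsDart x → IsDart (R w x))
                       (T : DartBijection) (m : ℕ)
                       (T-Rᵐ : ∀ x → IsDart x → DartBijection.to T ((R w ^ᵉ m) x) ≡ R w′ (DartBijection.to T x)) where

      open DartBijection T

      from-R : ∀ y → IsDart y → from (R w′ y) ≡ (R w ^ᵉ m) (from y)
      from-R y y-dart = begin
        from (R w′ y)                     ≡⟨ cong (from ∘ R w′) (to-from y y-dart) ⟨
        from (R w′ (to (from y)))         ≡⟨ cong from (T-Rᵐ (from y) (from-dart y y-dart)) ⟨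
        from (to ((R w ^ᵉ m) (from y)))   ≡⟨ from-to _ (Rⁿ-dart R-dart m (from y) (from-dart y y-dart)) ⟩
        (R w ^ᵉ m) (from y)               ∎
        where open ≡-Reasoning

      module _ (φ : Aut⁺ w) where

        conjugateFun : Pair → Pair
        conjugateFun = to ∘ fun φ ∘ from

        conjugateFun-dart : ∀ y → IsDart y → IsDart (conjugateFun y)
        conjugateFun-dart y y-dart = to-dart _ (fun-dart φ _ (from-dart y y-dart))

        conjugateFun-R : ∀ y → IsDart y → conjugateFun (R w′ y) ≡ R w′ (conjugateFun y)
        conjugateFun-R y y-dart = begin
          to (fun φ (from (R w′ y)))              ≡⟨ cong (to ∘ fun φ) (from-R y y-dart) ⟩
          to (fun φ ((R w ^ᵉ m) (from y)))        ≡⟨ cong to (fun-Rⁿ R-dart φ m _ (from-dart y y-dart)) ⟩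
          to ((R w ^ᵉ m) (fun φ (from y)))        ≡⟨ T-Rᵐ _ (fun-dart φ _ (from-dart y y-dart)) ⟩
          R w′ (to (fun φ (from y)))              ∎
          where open ≡-Reasoning

        conjugateFun-L : ∀ y → IsDart y → conjugateFun (L y) ≡ L (conjugateFun y)
        conjugateFun-L y y-dart = begin
          to (fun φ (from (L y)))   ≡⟨ cong (to ∘ fun φ) (from-L y y-dart) ⟩
          to (fun φ (L (from y)))   ≡⟨ cong to (comm-L φ _ (from-dart y y-dart)) ⟩
          to (L (fun φ (from y)))   ≡⟨ to-L _ (fun-dart φ _ (from-dart y y-dart)) ⟩
          L (to (fun φ (from y)))   ∎
          where open ≡-Reasoning

        conjugateFun-inverse : ∀ y → IsDart y → to (inv φ (from (conjugateFun y))) ≡ y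
        conjugateFun-inverse y y-dart = begin
          to (inv φ (from (to (fun φ (from y)))))   ≡⟨ cong (to ∘ inv φ) (from-to _ (fun-dart φ _ (from-dart y y-dart))) ⟩
          to (inv φ (fun φ (from y)))               ≡⟨ cong to (inv-fun φ _ (from-dart y y-dart)) ⟩
          to (from y)                               ≡⟨ to-from y y-dart ⟩
          y                                         ∎
          where open ≡-Reasoning

      conjugate : Aut⁺ w → Aut⁺ w′
      conjugate φ = record
        { fun        = conjugateFun φ
        ; inv        = conjugateFun (φ ⁻¹ᴬ)
        ; fun-dart   = conjugateFun-dart φ
        ; inv-dart   = conjugateFun-dart (φ ⁻¹ᴬ)
        ; inv-fun    = conjugateFun-inverse φ
        ; fun-inv    = conjugateFun-inverse (φ ⁻¹ᴬ)
        ; comm-R     = conjugateFun-R φ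
        ; comm-L     = conjugateFun-L φ
        ; inv-comm-R = conjugateFun-R (φ ⁻¹ᴬ)
        ; inv-comm-L = conjugateFun-L (φ ⁻¹ᴬ)
        }

    conjugation-isomorphism :
      ∀ {w w′} → (∀ x → IsDart x → IsDart (R w x)) → (∀ x → IsDart x → IsDart (R w′ x)) →
      (T : DartBijection) (a b : ℕ) → let open DartBijection T in
      (∀ x → IsDart x → to (R w x) ≡ (R w′ ^ᵉ a) (to x)) →
      (∀ x → IsDart x → to ((R w ^ᵉ b) x) ≡ R w′ (to x)) →
      IsomorphicAut⁺ w w′
    conjugation-isomorphism {w} {w′} R-dart R′-dart T a b T-R T-Rᵇ = Φ , record
      { isGroupMonomorphism = record
        { isGroupHomomorphism = record
          { isMonoidHomomorphism = record
            { isMagmaHomomorphism = record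
              { isRelHomomorphism = record { cong = λ φ≈ψ y y-dart → cong to (φ≈ψ _ (from-dart y y-dart)) }
              ; homo = λ φ ψ y y-dart → cong (to ∘ fun φ) (sym (from-to _ (fun-dart ψ _ (from-dart y y-dart)))) }
            ; ε-homo = to-from }
          ; ⁻¹-homo = λ _ _ _ → refl }
        ; injective = λ {φ} {ψ} → Φ-injective φ ψ }
      ; surjective = λ ψ → Ψ ψ , λ {z} → Φ-Ψ ψ z }
      where
      open DartBijection T

      from-Rᵃ : ∀ y → IsDart y → from ((R w′ ^ᵉ a) y) ≡ R w (from y)
      from-Rᵃ y y-dart = begin
        from ((R w′ ^ᵉ a) y)            ≡⟨ cong (from ∘ (R w′ ^ᵉ a)) (to-from y y-dart) ⟨
        from ((R w′ ^ᵉ a) (to (from y))) ≡⟨ cong from (T-R (from y) (from-dart y y-dart)) ⟨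
        from (to (R w (from y)))         ≡⟨ from-to _ (R-dart (from y) (from-dart y y-dart)) ⟩
        R w (from y)                     ∎
        where open ≡-Reasoning

      Φ : Aut⁺ w → Aut⁺ w′
      Φ = Conjugation.conjugate R-dart T b T-Rᵇ

      Ψ : Aut⁺ w′ → Aut⁺ w
      Ψ = Conjugation.conjugate R′-dart (invert T) a from-Rᵃ

      Φ-injective : ∀ φ ψ → Φ φ ≈ᴬ Φ ψ → φ ≈ᴬ ψ
      Φ-injective φ ψ Φφ≈Φψ x x-dart = begin
        fun φ x                       ≡⟨ from-to _ (fun-dart φ x x-dart) ⟨
        from (to (fun φ x))           ≡⟨ cong (from ∘ to ∘ fun φ) (from-to x x-dart) ⟨
        from (fun (Φ φ) (to x))       ≡⟨ cong from (Φφ≈Φψ (to x) (to-dart x x-dart)) ⟩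
        from (fun (Φ ψ) (to x))       ≡⟨ cong (from ∘ to ∘ fun ψ) (from-to x x-dart) ⟩
        from (to (fun ψ x))           ≡⟨ from-to _ (fun-dart ψ x x-dart) ⟩
        fun ψ x                       ∎
        where open ≡-Reasoning

      Φ-Ψ : ∀ ψ z → z ≈ᴬ Ψ ψ → Φ z ≈ᴬ ψ
      Φ-Ψ ψ z z≈Ψψ y y-dart = begin
        to (fun z (from y))                  ≡⟨ cong to (z≈Ψψ _ (from-dart y y-dart)) ⟩
        to (from (fun ψ (to (from y))))      ≡⟨ to-from _ (fun-dart ψ _ (to-dart _ (from-dart y y-dart))) ⟩
        fun ψ (to (from y))                  ≡⟨ cong (fun ψ) (to-from y y-dart) ⟩
        fun ψ y                              ∎
        where open ≡-Reasoning

    module _ .{{_ : NonZero d}} where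

      -- orbit w t = e₁M_w^t, with the paper's e₁ being the basis vector at index zero.
      orbit : Carrier → ℕ → V
      orbit w t = scaledBasis (w ^ (t / d)) (t mod d)

      orbit-unique : ∀ w {t} a r → t ≡ toℕ r + a * d → orbit w t ≡ scaledBasis (w ^ a) r
      orbit-unique w a r t≡r+ad with divMod-unique a r t≡r+ad
      ... | t/d≡a , t%d≡r = cong₂ (λ e i → scaledBasis (w ^ e) i) t/d≡a t%d≡r

      orbit-suc : ∀ w t → orbit w t ·ₘ Mω w ≡ orbit w (suc t)
      orbit-suc w t with suc (toℕ r) ℕ.<? d
        where r = t mod d
      ... | yes 1+r<d = begin
        scaledBasis (w ^ Q) r ·ₘ Mω w  ≡⟨ scaledBasis-·ₘ (w ^ Q) 1# j (Mω-row-next w r j (toℕ-fromℕ< 1+r<d)) ⟩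
        scaledBasis (w ^ Q ⊗ 1#) j     ≡⟨ cong (λ c → scaledBasis c j) (*-identityʳ _) ⟩
        scaledBasis (w ^ Q) j          ≡⟨ orbit-unique w Q j 1+t≡j+Qd ⟨
        orbit w (suc t)                ∎
        where
        open ≡-Reasoning
        r = t mod d
        Q = t / d
        j = Fin.fromℕ< 1+r<d
        1+t≡j+Qd : suc t ≡ toℕ j + Q * d
        1+t≡j+Qd = trans (cong suc (divMod-property t d)) (cong (_+ Q * d) (sym (toℕ-fromℕ< 1+r<d)))
      ... | no 1+r≮d = begin
        scaledBasis (w ^ Q) r ·ₘ Mω w  ≡⟨ scaledBasis-·ₘ (w ^ Q) w j (Mω-row-last w r j 1+r≡d (toℕ-fromℕ< (ℕ.>-nonZero⁻¹ d))) ⟩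
        scaledBasis (w ^ Q ⊗ w) j      ≡⟨ cong (λ c → scaledBasis c j) (*-comm _ w) ⟩
        scaledBasis (w ^ suc Q) j      ≡⟨ orbit-unique w (suc Q) j 1+t≡j+[1+Q]d ⟨
        orbit w (suc t)                ∎
        where
        open ≡-Reasoning
        r = t mod d
        Q = t / d
        j = Fin.fromℕ< (ℕ.>-nonZero⁻¹ d)
        1+r≡d : suc (toℕ r) ≡ d
        1+r≡d = ℕ.≤-antisym (toℕ<n r) (ℕ.≮⇒≥ 1+r≮d)
        1+t≡j+[1+Q]d : suc t ≡ toℕ j + suc Q * d
        1+t≡j+[1+Q]d = trans (cong suc (divMod-property t d))
                             (trans (cong (_+ Q * d) 1+r≡d) (cong (_+ suc Q * d) (sym (toℕ-fromℕ< (ℕ.>-nonZero⁻¹ d)))))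

      orbit-periodic : ∀ w {e} → w ^ e ≡ 1# → ∀ t k → orbit w (t + k * (d * e)) ≡ orbit w t
      orbit-periodic w {e} w^e≡1 t k = begin
        orbit w (t + k * (d * e))                  ≡⟨ orbit-unique w (t / d + e * k) r shift ⟩
        scaledBasis (w ^ (t / d + e * k)) r        ≡⟨ cong (λ c → scaledBasis c r) (^-homo-* w (t / d) (e * k)) ⟩
        scaledBasis (w ^ (t / d) ⊗ w ^ (e * k)) r  ≡⟨ cong (λ c → scaledBasis (w ^ (t / d) ⊗ c) r) (^≡1⇒^*≡1 e w^e≡1 k) ⟩
        scaledBasis (w ^ (t / d) ⊗ 1#) r           ≡⟨ cong (λ c → scaledBasis c r) (*-identityʳ _) ⟩
        orbit w t                                  ∎
        where
        open ≡-Reasoning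
        r = t mod d
        shift : t + k * (d * e) ≡ toℕ r + (t / d + e * k) * d
        shift = trans (cong (_+ k * (d * e)) (divMod-property t d)) (regroup (toℕ r) (t / d) k d e)
          where
          regroup : ∀ r Q k d e → r + Q * d + k * (d * e) ≡ r + (Q + e * k) * d
          regroup = solve-∀

      orbit-InS : ∀ {w} → ¬ w ≡ 0# → ∀ t → InS (orbit w t)
      orbit-InS w≢0 t = t mod d , _ , ^-nonzero (t / d) w≢0 , refl

      InS⇒orbit : ∀ {w} → IsGenerator w → ∀ {s} → InS s → ∃[ t ] s ≡ orbit w t
      InS⇒orbit {w} (_ , generates) (i , c , c≢0 , s≡ceᵢ) with generates c c≢0
      ... | k , c≡wᵏ = toℕ i + k * d , trans s≡ceᵢ (trans (cong (λ c → scaledBasis c i) (trans c≡wᵏ (pow≡^ w k)))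
                                                          (sym (orbit-unique w k i refl)))

      R-dart : ∀ {w} → IsGenerator w → ∀ x → IsDart x → IsDart (R w x)
      R-dart {w} w-gen (v , s) s-dart with InS⇒orbit w-gen s-dart
      ... | t , refl = subst InS (sym (orbit-suc w t)) (orbit-InS (proj₁ w-gen) (suc t))

      Rⁿ-orbit : ∀ w n v t → (R w ^ᵉ n) (v , orbit w t) ≡ (v , orbit w (n + t))
      Rⁿ-orbit w zero    v t = refl
      Rⁿ-orbit w (suc n) v t = trans (cong (R w) (Rⁿ-orbit w n v t)) (cong (v ,_) (orbit-suc w (n + t)))

      Rⁿ-periodic : ∀ {w e} → IsGenerator w → w ^ e ≡ 1# → ∀ k x → IsDart x → (R w ^ᵉ (1 + k * (d * e))) x ≡ R w x
      Rⁿ-periodic {w} {e} w-gen w^e≡1 k (v , s) s-dart with InS⇒orbit w-gen s-dart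
      ... | t , refl = begin
        (R w ^ᵉ (1 + k * (d * e))) (v , orbit w t)   ≡⟨ Rⁿ-orbit w _ v t ⟩
        (v , orbit w (1 + k * (d * e) + t))          ≡⟨ cong (λ n → v , orbit w n) (ℕ.+-comm (suc (k * (d * e))) t) ⟩
        (v , orbit w (t + suc (k * (d * e))))        ≡⟨ cong (λ n → v , orbit w n) (ℕ.+-suc t _) ⟩
        (v , orbit w (suc t + k * (d * e)))          ≡⟨ cong (v ,_) (orbit-periodic w w^e≡1 (suc t) k) ⟩
        (v , orbit w (suc t))                        ≡⟨ cong (v ,_) (orbit-suc w t) ⟨
        R w (v , orbit w t)                          ∎
        where open ≡-Reasoning

      module Relabelling {ω ω′ : Carrier} (ω-gen : IsGenerator ω) (ω′-gen : IsGenerator ω′)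
                         (e u u′ y : ℕ) (ω′^e≡1 : ω′ ^ e ≡ 1#) (ω′^u≡ω : ω′ ^ u ≡ ω)
                         (uu′≡1+y·de : u * u′ ≡ 1 + y * (d * e)) where

        π : Permutation′ d
        π = *-permutation u u′ (y * e) (trans uu′≡1+y·de (cong suc (regroup y d e)))
          where
          regroup : ∀ y d e → y * (d * e) ≡ y * e * d
          regroup = solve-∀

        scale : Fin d → Carrier
        scale i = ω′ ^ ((u * toℕ i) / d)

        T : DartBijection
        T = monomialBijection π scale (λ i → ^-nonzero ((u * toℕ i) / d) (proj₁ ω′-gen))

        open DartBijection T

        monomial-orbit : ∀ x → monomial π scale (orbit ω x) ≡ orbit ω′ (u * x)
        monomial-orbit x = begin
          monomial π scale (scaledBasis (ω ^ Q) r)  ≡⟨ monomial-scaledBasis π scale (ω ^ Q) r ⟩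
          scaledBasis (scale r ⊗ ω ^ Q) (π ⟨$⟩ʳ r)   ≡⟨ cong (λ c → scaledBasis (scale r ⊗ c) (π ⟨$⟩ʳ r)) ω^Q≡ω′^uQ ⟩
          scaledBasis (scale r ⊗ ω′ ^ (u * Q)) (π ⟨$⟩ʳ r) ≡⟨ cong (λ c → scaledBasis c (π ⟨$⟩ʳ r)) (^-homo-* ω′ P (u * Q)) ⟨
          scaledBasis (ω′ ^ (P + u * Q)) (π ⟨$⟩ʳ r)  ≡⟨ orbit-unique ω′ (P + u * Q) (π ⟨$⟩ʳ r) ux≡πr+[P+uQ]d ⟨
          orbit ω′ (u * x)                           ∎
          where
          open ≡-Reasoning
          r = x mod d
          Q = x / d
          P = (u * toℕ r) / d
          ω^Q≡ω′^uQ : ω ^ Q ≡ ω′ ^ (u * Q)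
          ω^Q≡ω′^uQ = trans (cong (_^ Q) (sym ω′^u≡ω)) (^-assocʳ ω′ u Q)
          ux≡πr+[P+uQ]d : u * x ≡ toℕ (π ⟨$⟩ʳ r) + (P + u * Q) * d
          ux≡πr+[P+uQ]d = begin
            u * x                              ≡⟨ cong (u *_) (divMod-property x d) ⟩
            u * (toℕ r + Q * d)                ≡⟨ expand u (toℕ r) Q d ⟩
            u * toℕ r + u * Q * d              ≡⟨ cong (_+ u * Q * d) (divMod-property (u * toℕ r) d) ⟩
            toℕ (π ⟨$⟩ʳ r) + P * d + u * Q * d ≡⟨ regroup (toℕ (π ⟨$⟩ʳ r)) P u Q d ⟩
            toℕ (π ⟨$⟩ʳ r) + (P + u * Q) * d   ∎
            where
            expand : ∀ u r Q d → u * (r + Q * d) ≡ u * r + u * Q * d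
            expand = solve-∀
            regroup : ∀ s P u Q d → s + P * d + u * Q * d ≡ s + (P + u * Q) * d
            regroup = solve-∀

        to-Rⁿ : ∀ n x → IsDart x → to ((R ω ^ᵉ n) x) ≡ (R ω′ ^ᵉ (u * n)) (to x)
        to-Rⁿ n (v , s) s-dart with InS⇒orbit ω-gen s-dart
        ... | t , refl = begin
          to ((R ω ^ᵉ n) (v , orbit ω t))                 ≡⟨ cong to (Rⁿ-orbit ω n v t) ⟩
          (A v , A (orbit ω (n + t)))                     ≡⟨ cong (A v ,_) (monomial-orbit (n + t)) ⟩
          (A v , orbit ω′ (u * (n + t)))                  ≡⟨ cong (λ k → A v , orbit ω′ k) (ℕ.*-distribˡ-+ u n t) ⟩
          (A v , orbit ω′ (u * n + u * t))                ≡⟨ Rⁿ-orbit ω′ (u * n) (A v) (u * t) ⟨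
          (R ω′ ^ᵉ (u * n)) (A v , orbit ω′ (u * t))      ≡⟨ cong (λ s → (R ω′ ^ᵉ (u * n)) (A v , s)) (monomial-orbit t) ⟨
          (R ω′ ^ᵉ (u * n)) (to (v , orbit ω t))          ∎
          where
          open ≡-Reasoning
          A = monomial π scale

        isomorphism : IsomorphicAut⁺ ω ω′
        isomorphism = conjugation-isomorphism (R-dart ω-gen) (R-dart ω′-gen) T u u′
          (λ x x-dart → trans (to-Rⁿ 1 x x-dart) (cong (λ n → (R ω′ ^ᵉ n) (to x)) (ℕ.*-identityʳ u)))
          (λ x x-dart → trans (to-Rⁿ u′ x x-dart)
                          (trans (cong (λ n → (R ω′ ^ᵉ n) (to x)) uu′≡1+y·de) (Rⁿ-periodic ω′-gen ω′^e≡1 y (to x) (to-dart x x-dart))))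

      Aut⁺-isomorphic-self : ∀ {w} → IsGenerator w → IsomorphicAut⁺ w w
      Aut⁺-isomorphic-self w-gen =
        conjugation-isomorphism (R-dart w-gen) (R-dart w-gen) identityBijection 1 1 (λ _ _ → refl) (λ _ _ → refl)

      -- With ω = ω′ᴶ and ω′ = ωᴷ, the exponent e = JK - 1 satisfies ω′ᵉ = 1 and gcd(J, e) = 1;
      -- JK ≤ 1 forces ω = ω′.
      Aut⁺-isomorphic : ∀ {ω ω′} → IsGenerator ω → IsGenerator ω′ → IsomorphicAut⁺ ω ω′
      Aut⁺-isomorphic {ω} {ω′} ω-gen@(ω≢0 , ω-generates) ω′-gen@(ω′≢0 , ω′-generates)
        with ω′-generates ω ω≢0 | ω-generates ω′ ω′≢0
      ... | J , ω≡ω′ᴶ | K , ω′≡ωᴷ = by-exponent (J * K) refl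
        where
        ω≡ω′^J : ω ≡ ω′ ^ J
        ω≡ω′^J = trans ω≡ω′ᴶ (pow≡^ ω′ J)
        ω′^JK≡ω′ : ω′ ^ (J * K) ≡ ω′
        ω′^JK≡ω′ = trans (sym (^-assocʳ ω′ J K)) (trans (cong (_^ K) (sym ω≡ω′^J)) (sym (trans ω′≡ωᴷ (pow≡^ ω K))))

        by-exponent : ∀ n → J * K ≡ n → IsomorphicAut⁺ ω ω′
        by-exponent zero JK≡0 = subst (IsomorphicAut⁺ ω) ω≡ω′ (Aut⁺-isomorphic-self ω-gen)
          where
          ω′≡1 : ω′ ≡ 1#
          ω′≡1 = trans (sym ω′^JK≡ω′) (cong (ω′ ^_) JK≡0)
          ω≡ω′ : ω ≡ ω′
          ω≡ω′ = trans ω≡ω′^J (trans (cong (_^ J) ω′≡1) (trans (1^n≡1 J) (sym ω′≡1)))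
        by-exponent (suc zero) JK≡1 = subst (IsomorphicAut⁺ ω)
          (trans ω≡ω′^J (trans (cong (ω′ ^_) (ℕ.m*n≡1⇒m≡1 J K JK≡1)) (*-identityʳ ω′))) (Aut⁺-isomorphic-self ω-gen)
        by-exponent (suc (suc e′)) JK≡1+e = Relabelling.isomorphism ω-gen ω′-gen e u u′ y ω′^e≡1 ω′^u≡ω uu′≡1+y·de
          where
          e = suc e′
          instance
            J≢0 : NonZero J
            J≢0 = ℕ.m*n≢0⇒m≢0 J {{subst NonZero (sym JK≡1+e) _}}
            de≢0 : NonZero (d * e)
            de≢0 = ℕ.m*n≢0 d e
          ω′^e≡1 : ω′ ^ e ≡ 1#
          ω′^e≡1 = *-cancelˡ-nonzero ω′≢0 (trans (trans (cong (ω′ ^_) (sym JK≡1+e)) ω′^JK≡ω′) (sym (*-identityʳ ω′)))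
          t = coprimeProduct J (d * e)
          u = J + e * t
          instance
            u≢0 : NonZero u
            u≢0 = ℕ.>-nonZero (ℕ.≤-trans (ℕ.>-nonZero⁻¹ J) (ℕ.m≤m+n J (e * t)))
          u⊥de = coprime-shift J e (d * e) (*≡suc⇒coprime J K e JK≡1+e)
          u′ = proj₁ (coprime⇒inverse u (d * e) u⊥de)
          y = proj₁ (proj₂ (coprime⇒inverse u (d * e) u⊥de))
          uu′≡1+y·de = proj₂ (proj₂ (coprime⇒inverse u (d * e) u⊥de))
          ω′^u≡ω : ω′ ^ u ≡ ω
          ω′^u≡ω = trans (^-homo-* ω′ J (e * t)) (trans (cong₂ _⊗_ (sym ω≡ω′^J) (^≡1⇒^*≡1 e ω′^e≡1 t)) (*-identityʳ ω))

lemma3p4 : (q : ℕ) → IsPrimePower q → (F : FiniteField q) → (d : ℕ) → 1 ≤ d →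
    (ω ω′ : FiniteField.Carrier F) →
    FiniteField.IsGenerator F ω → FiniteField.IsGenerator F ω′ →
    ∃ λ (Φ : Hamming.Aut⁺ F d ω → Hamming.Aut⁺ F d ω′) →
      GroupMorphisms.IsGroupIsomorphism
        (Hamming.Aut⁺-RawGroup F d ω) (Hamming.Aut⁺-RawGroup F d ω′) Φ
lemma3p4 q _ F d 1≤d ω ω′ ω-gen ω′-gen = Aut⁺-isomorphic F d {{ℕ.>-nonZero 1≤d}} ω-gen ω′-gen
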